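{- Let $f$ be an independent broadcast on a graph $G$. Let $H_1, \dots, H_k$ be pairwise vertex-disjoint isometric subgraphs of $G$ such that, for each $i$, at least two vertices $v \in V(H_i)$ satisfy $f(v) > 0$. Then \[ f(V(G)) \leq \sum_{i=1}^{k} \alpha_b(H_i) + \sum_{v \in V(G) \setminus \bigcup_{i=1}^k V(H_i)} f(v). \]
   Context: All graphs are finite, simple, undirected and connected. For a graph $G$, $d(u,v)$ is the distance, $\mathrm{ecc}(v)$ the eccentricity, $\mathrm{diam}(G)$ the diameter. A broadcast on $G$ is a function $f: V(G)\to\{0,\dots,\mathrm{diam}(G)\}$ with $f(v)\le\mathrm{ecc}(v)$; for $X\subseteq V(G)$, $f(X)=\sum_{v\in X} f(v)$. A vertex $v$ is broadcasting if $f(v)>0$; $u$ hears a broadcasting $v$ if $d(u,v)\le f(v)$. A broadcast is independent if every broadcasting vertex hears only itself; $\alpha_b(G)$ is the maximum weight of an independent broadcast on $G$. A subgraph $H$ of $G$ is isometric if $d_H(x,y)=d_G(x,y)$ for all $x,y\in V(H)$. -}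

module Defs where

open import Data.Nat using (ℕ; zero; suc; _+_; _≤_; _<_; _⊔_)
open import Data.Bool using (Bool; true; false; _∧_; _∨_; if_then_else_)
open import Data.Fin using (Fin; _≟_)
open import Data.List using (List; map; foldr; allFin)
open import Data.Bool.ListAction using (any)
open import Data.Product using (Σ; ∃; ∃-syntax; _×_)
open import Relation.Nullary using (¬_)
open import Relation.Nullary.Decidable using (⌊_⌋)
open import Relation.Binary.PropositionalEquality using (_≡_)

Σ[Fin] : (n : ℕ) → (Fin n → ℕ) → ℕ
Σ[Fin] zero    f = 0
Σ[Fin] (suc n) f = f Fin.zero + Σ[Fin] n (λ i → f (Fin.suc i))

anyFin : (n : ℕ) → (Fin n → Bool) → Bool
anyFin n p = any p (allFin n)

maxFin : (n : ℕ) → (Fin n → ℕ) → ℕ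
maxFin n g = foldr _⊔_ 0 (map g (allFin n))

module _ {n : ℕ} (adj : Fin n → Fin n → Bool) where

  -- reach k u v = true  iff  there is a u–v walk of length ≤ k
  reachA : ℕ → Fin n → Fin n → Bool
  reachA zero    u v = ⌊ u ≟ v ⌋
  reachA (suc k) u v = reachA k u v ∨ anyFin n (λ w → adj u w ∧ reachA k w v)

  firstReach : ℕ → ℕ → Fin n → Fin n → ℕ
  firstReach zero       k u v = k
  firstReach (suc fuel) k u v =
    if reachA k u v then k else firstReach fuel (suc k) u v

record SimpleGraph : Set where
  field
    n   : ℕ
    adj : Fin n → Fin n → Bool
    adj-sym    : ∀ u v → adj u v ≡ adj v u
    adj-irrefl : ∀ u → adj u u ≡ false
    connected  : ∀ u v → ∃[ k ] (reachA adj k u v ≡ true)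

open SimpleGraph public

-- graph distance d(u,v): least length of a u–v walk
-- (in a connected graph a walk of length ≤ n - 1 exists, so fuel n suffices)
dist : (G : SimpleGraph) → Fin (n G) → Fin (n G) → ℕ
dist G u v = firstReach (adj G) (n G) 0 u v

ecc : (G : SimpleGraph) → Fin (n G) → ℕ
ecc G v = maxFin (n G) (λ u → dist G v u)

diam : SimpleGraph → ℕ
diam G = maxFin (n G) (ecc G)


module _ (G : SimpleGraph) where

  IsBroadcast : (Fin (n G) → ℕ) → Set
  IsBroadcast f = (∀ v → f v ≤ diam G) × (∀ v → f v ≤ ecc G v)

  Hears : (Fin (n G) → ℕ) → Fin (n G) → Fin (n G) → Set
  Hears f u v = dist G u v ≤ f v

  IsIndependent : (Fin (n G) → ℕ) → Set
  IsIndependent f = ∀ v u → 0 < f v → 0 < f u → Hears f v u → u ≡ v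

  weight : (Fin (n G) → ℕ) → ℕ
  weight f = Σ[Fin] (n G) f

  IsAlphaB : ℕ → Set
  IsAlphaB a =
    (Σ (Fin (n G) → ℕ) λ f → IsBroadcast f × IsIndependent f × weight f ≡ a)
    × (∀ f → IsBroadcast f → IsIndependent f → weight f ≤ a)

IsIsometricSubgraph : (G H : SimpleGraph) → (Fin (n H) → Fin (n G)) → Set
IsIsometricSubgraph G H e =
  (∀ x y → e x ≡ e y → x ≡ y)
  × (∀ x y → adj H x y ≡ true → adj G (e x) (e y) ≡ true)
  × (∀ x y → dist H x y ≡ dist G (e x) (e y))

inUnion : (G : SimpleGraph) (k : ℕ) (H : Fin k → SimpleGraph)
          (e : (i : Fin k) → Fin (n (H i)) → Fin (n G)) → Fin (n G) → Bool
inUnion G k H e v = anyFin k (λ i → anyFin (n (H i)) (λ x → ⌊ e i x ≟ v ⌋))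

-- Restricted to an isometric subgraph H, an independent broadcast stays
-- independent, since distances do not change. If at least two vertices of H
-- broadcast, no vertex of H can reach beyond its eccentricity in H (it would
-- then be heard by the other broadcasting vertex), so the restriction is a
-- broadcast on H and its weight is at most α_b(H). Finally, every vertex of G
-- is either outside all the H_i or counted at least once in some restriction.
module Submission where

open import Defs
open import Data.Bool using (Bool; true; false; if_then_else_; T)
open import Data.Bool.Properties using (T-≡; T-∨; T-∧; ⇔→≡)
open import Data.Fin using (Fin; zero; suc; _≟_)
open import Data.List using (_∷_; foldr; allFin)
open import Data.List.Membership.Propositional using (_∈_; lose)
open import Data.List.Membership.Propositional.Properties using (∈-map⁺; ∈-allFin)
open import Data.List.Relation.Unary.Any using (here; there; satisfied)
open import Data.List.Relation.Unary.Any.Properties using (any⁺; any⁻)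
open import Data.Nat using (ℕ; zero; suc; _+_; _≤_; _<_; _⊔_; z≤n)
open import Data.Nat.Properties
  using (+-0-commutativeMonoid; ≤-trans; ≤-<-trans; <⇒≤; ≮⇒≥;
         +-mono-≤; +-monoˡ-≤; module ≤-Reasoning; +-identityʳ; m≤m+n; m≤n+m; m≤m⊔n; m≤n⊔m)
open import Algebra.Properties.CommutativeMonoid.Sum +-0-commutativeMonoid
  using (sum; sum-syntax; sum-cong-≗; ∑-distrib-+; ∑-comm; sum-replicate-zero)
open import Data.Product using (∃-syntax; _×_; _,_)
open import Data.Sum using (inj₁; inj₂)
open import Function using (_∘_; mk⇔)
open import Function.Bundles using (Equivalence)
open import Relation.Nullary using (¬_; does; yes; no)
open import Relation.Nullary.Decidable using (⌊_⌋; toWitness; fromWitness; dec-true)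
open import Relation.Binary.PropositionalEquality
  using (_≡_; _≢_; refl; sym; cong; cong₂; subst; module ≡-Reasoning)

open Equivalence using (to; from)

anyFin-intro : ∀ n (p : Fin n → Bool) i → T (p i) → T (anyFin n p)
anyFin-intro n p i pi = any⁺ p (lose (∈-allFin i) pi)

anyFin-witness : ∀ n (p : Fin n → Bool) → T (anyFin n p) → ∃[ i ] T (p i)
anyFin-witness n p h = satisfied (any⁻ p (allFin n) h)

≤-maxFin : ∀ n (g : Fin n → ℕ) i → g i ≤ maxFin n g
≤-maxFin n g i = ≤-foldr-⊔ (∈-map⁺ g (∈-allFin i))
  where
  ≤-foldr-⊔ : ∀ {x xs} → x ∈ xs → x ≤ foldr _⊔_ 0 xs
  ≤-foldr-⊔ {xs = y ∷ ys} (here refl) = m≤m⊔n y _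
  ≤-foldr-⊔ {xs = y ∷ ys} (there x∈ys) = ≤-trans (≤-foldr-⊔ x∈ys) (m≤n⊔m y _)

module _ {n : ℕ} (adj : Fin n → Fin n → Bool) (adj-sym : ∀ u v → adj u v ≡ adj v u) where

  reach-suc : ∀ k {u v} → T (reachA adj k u v) → T (reachA adj (suc k) u v)
  reach-suc k r = from T-∨ (inj₁ r)

  reach-cons : ∀ k {u w v} → T (adj u w) → T (reachA adj k w v) → T (reachA adj (suc k) u v)
  reach-cons k {w = w} a r = from T-∨ (inj₂ (anyFin-intro n _ w (from T-∧ (a , r))))

  reach-snoc : ∀ k {u w v} → T (reachA adj k u w) → T (adj w v) → T (reachA adj (suc k) u v)
  reach-snoc zero r a with refl ← toWitness r = reach-cons zero a (fromWitness refl)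
  reach-snoc (suc k) r a with to T-∨ r
  ... | inj₁ r′ = reach-suc (suc k) (reach-snoc k r′ a)
  ... | inj₂ s with anyFin-witness n _ s
  ...   | w′ , q with to T-∧ q
  ...     | a′ , r′ = reach-cons (suc k) a′ (reach-snoc k r′ a)

  reach-flip : ∀ k {u v} → T (reachA adj k u v) → T (reachA adj k v u)
  reach-flip zero r with refl ← toWitness r = fromWitness refl
  reach-flip (suc k) r with to T-∨ r
  ... | inj₁ r′ = reach-suc k (reach-flip k r′)
  ... | inj₂ s with anyFin-witness n _ s
  ...   | w , q with to T-∧ q
  ...     | a , r′ = reach-snoc k (reach-flip k r′) (subst T (adj-sym _ w) a)

  reach-sym : ∀ k u v → reachA adj k u v ≡ reachA adj k v u
  reach-sym k u v = ⇔→≡ {z = true} (mk⇔ (to T-≡ ∘ reach-flip k ∘ from T-≡)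
                                         (to T-≡ ∘ reach-flip k ∘ from T-≡))

  firstReach-sym : ∀ fuel k u v → firstReach adj fuel k u v ≡ firstReach adj fuel k v u
  firstReach-sym zero k u v = refl
  firstReach-sym (suc fuel) k u v
    rewrite reach-sym k u v | firstReach-sym fuel (suc k) u v = refl

dist-sym : ∀ G u v → dist G u v ≡ dist G v u
dist-sym G = firstReach-sym (adj G) (adj-sym G) (n G) 0

dist≤ecc : ∀ G v u → dist G v u ≤ ecc G v
dist≤ecc G v = ≤-maxFin (n G) (dist G v)

ecc≤diam : ∀ G v → ecc G v ≤ diam G
ecc≤diam G = ≤-maxFin (n G) (ecc G)

HasTwoBroadcasters : (G : SimpleGraph) → (Fin (n G) → ℕ) → Set
HasTwoBroadcasters G g = ∃[ x ] ∃[ y ] (x ≢ y × 0 < g x × 0 < g y)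

broadcaster-≢ : ∀ {G g} → HasTwoBroadcasters G g → ∀ x → ∃[ z ] (z ≢ x × 0 < g z)
broadcaster-≢ (a , b , a≢b , ga , gb) x with a ≟ x
... | no a≢x = a , a≢x , ga
... | yes refl = b , a≢b ∘ sym , gb

independent⇒≤ecc : ∀ {G g} → IsIndependent G g → HasTwoBroadcasters G g →
                   ∀ x → g x ≤ ecc G x
independent⇒≤ecc {G} {g} ind two x = ≮⇒≥ λ ecc<gx →
  let (z , z≢x , gz>0) = broadcaster-≢ {G} {g} two x
      z-hears-x = ≤-trans (subst (_≤ ecc G x) (dist-sym G x z) (dist≤ecc G x z)) (<⇒≤ ecc<gx)
  in z≢x (sym (ind z x gz>0 (≤-<-trans z≤n ecc<gx) z-hears-x))

independent⇒broadcast : ∀ {G g} → IsIndependent G g → HasTwoBroadcasters G g →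
                        IsBroadcast G g
independent⇒broadcast {G} {g} ind two =
  (λ x → ≤-trans (≤ecc x) (ecc≤diam G x)) , ≤ecc
  where
  ≤ecc : ∀ x → g x ≤ ecc G x
  ≤ecc = independent⇒≤ecc {G} {g} ind two

restriction-independent : ∀ {G H e f} → IsIsometricSubgraph G H e →
                          IsIndependent G f → IsIndependent H (f ∘ e)
restriction-independent {G} {H} {e} {f} (e-inj , _ , e-dist) ind v u fv>0 fu>0 v-hears-u =
  e-inj u v (ind (e v) (e u) fv>0 fu>0 (subst (_≤ f (e u)) (e-dist v u) v-hears-u))

restriction-weight≤α : ∀ {G H e f a} → IsIsometricSubgraph G H e → IsIndependent G f →
                       HasTwoBroadcasters H (f ∘ e) → IsAlphaB H a → weight H (f ∘ e) ≤ a
restriction-weight≤α {G} {H} {e} {f} iso ind two (_ , maximal) =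
  maximal (f ∘ e) (independent⇒broadcast {H} ind′ two) ind′
  where
  ind′ : IsIndependent H (f ∘ e)
  ind′ = restriction-independent {G} {H} {e} {f} iso ind

Σ[Fin]≡sum : ∀ n (g : Fin n → ℕ) → Σ[Fin] n g ≡ sum g
Σ[Fin]≡sum zero g = refl
Σ[Fin]≡sum (suc n) g = cong (g zero +_) (Σ[Fin]≡sum n (g ∘ suc))

sum-mono : ∀ {n} {g h : Fin n → ℕ} → (∀ i → g i ≤ h i) → sum g ≤ sum h
sum-mono {zero} g≤h = z≤n
sum-mono {suc n} g≤h = +-mono-≤ (g≤h zero) (sum-mono (g≤h ∘ suc))

≤-sum : ∀ {n} (g : Fin n → ℕ) i → g i ≤ sum g
≤-sum g zero = m≤m+n _ _
≤-sum g (suc i) = ≤-trans (≤-sum (g ∘ suc) i) (m≤n+m _ _)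

only : ∀ {n} → Fin n → (Fin n → ℕ) → Fin n → ℕ
only a g v = if does (a ≟ v) then g v else 0

sum-only : ∀ {n} a (g : Fin n → ℕ) → sum (only a g) ≡ g a
sum-only {suc n} zero g = begin
  g zero + sum {n} (λ _ → 0) ≡⟨ cong (g zero +_) (sum-replicate-zero n) ⟩
  g zero + 0             ≡⟨ +-identityʳ (g zero) ⟩
  g zero                 ∎
  where open ≡-Reasoning
sum-only (suc a) g = sum-only a (g ∘ suc)

covered : ∀ {N k} (m : Fin k → ℕ) → ((i : Fin k) → Fin (m i) → Fin N) → Fin N → Bool
covered {k = k} m e v = anyFin k (λ i → anyFin (m i) (λ x → ⌊ e i x ≟ v ⌋))

-- Images are counted with multiplicity.
sum≤sum-images+uncovered :
  ∀ {N k} (m : Fin k → ℕ) (e : (i : Fin k) → Fin (m i) → Fin N) (g : Fin N → ℕ) →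
  sum g ≤ ∑[ i < k ] sum (g ∘ e i) + ∑[ v < N ] (if covered m e v then 0 else g v)
sum≤sum-images+uncovered {N} {k} m e g = begin
  sum g                          ≤⟨ sum-mono g≤hits+rest ⟩
  ∑[ v < N ] (hits v + rest v)   ≡⟨ ∑-distrib-+ hits rest ⟩
  sum hits + sum rest            ≡⟨ cong (_+ sum rest) sum-hits ⟩
  ∑[ i < k ] sum (g ∘ e i) + sum rest ∎
  where
  open ≤-Reasoning
  hits rest : Fin N → ℕ
  hits v = ∑[ i < k ] ∑[ x < m i ] only (e i x) g v
  rest v = if covered m e v then 0 else g v

  g≤hits+rest : ∀ v → g v ≤ hits v + rest v
  g≤hits+rest v with covered m e v in cov
  ... | false = m≤n+m _ _
  ... | true with anyFin-witness k _ (from T-≡ cov)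
  ...   | i , hit with anyFin-witness (m i) _ hit
  ...     | x , ex≡v with refl ← toWitness ex≡v = begin
    g v                                ≡⟨ only-self ⟨
    only (e i x) g v                   ≤⟨ ≤-sum (λ x → only (e i x) g v) x ⟩
    ∑[ x < m i ] only (e i x) g v      ≤⟨ ≤-sum (λ i → ∑[ x < m i ] only (e i x) g v) i ⟩
    hits v                             ≤⟨ m≤m+n (hits v) 0 ⟩
    hits v + 0                         ∎
    where
    only-self : only v g v ≡ g v
    only-self rewrite dec-true (v ≟ v) refl = refl

  sum-hits : sum hits ≡ ∑[ i < k ] sum (g ∘ e i)
  sum-hits = ≡.begin
    ∑[ v < N ] ∑[ i < k ] ∑[ x < m i ] only (e i x) g v
      ≡.≡⟨ ∑-comm (λ v i → ∑[ x < m i ] only (e i x) g v) ⟩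
    ∑[ i < k ] ∑[ v < N ] ∑[ x < m i ] only (e i x) g v
      ≡.≡⟨ sum-cong-≗ (λ i → ∑-comm (λ v x → only (e i x) g v)) ⟩
    ∑[ i < k ] ∑[ x < m i ] ∑[ v < N ] only (e i x) g v
      ≡.≡⟨ sum-cong-≗ (λ i → sum-cong-≗ (λ x → sum-only (e i x) g)) ⟩
    ∑[ i < k ] sum (g ∘ e i)
      ≡.∎
    where module ≡ = ≡-Reasoning

mainTheorem12 : (G : SimpleGraph) (f : Fin (n G) → ℕ) →
    IsBroadcast G f → IsIndependent G f →
    (k : ℕ) (H : Fin k → SimpleGraph)
    (e : (i : Fin k) → Fin (n (H i)) → Fin (n G)) →
    (∀ i → IsIsometricSubgraph G (H i) (e i)) →
    (∀ i j x y → e i x ≡ e j y → i ≡ j) →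
    (∀ i → ∃[ x ] ∃[ y ] (¬ (x ≡ y) × 0 < f (e i x) × 0 < f (e i y))) →
    (α : Fin k → ℕ) → (∀ i → IsAlphaB (H i) (α i)) →
    weight G f ≤ Σ[Fin] k α
    + Σ[Fin] (n G) (λ v → if inUnion G k H e v then 0 else f v)
mainTheorem12 G f _ ind k H e iso _ two α αb = begin
  weight G f                               ≡⟨ Σ[Fin]≡sum (n G) f ⟩
  sum f                                    ≤⟨ sum≤sum-images+uncovered (n ∘ H) e f ⟩
  ∑[ i < k ] sum (f ∘ e i) + sum rest      ≤⟨ +-monoˡ-≤ (sum rest) (sum-mono weight≤α) ⟩
  sum α + sum rest                         ≡⟨ sym (cong₂ _+_ (Σ[Fin]≡sum k α) (Σ[Fin]≡sum (n G) rest)) ⟩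
  Σ[Fin] k α + Σ[Fin] (n G) rest           ∎
  where
  open ≤-Reasoning
  rest : Fin (n G) → ℕ
  rest v = if inUnion G k H e v then 0 else f v

  weight≤α : ∀ i → sum (f ∘ e i) ≤ α i
  weight≤α i = subst (_≤ α i) (Σ[Fin]≡sum (n (H i)) (f ∘ e i))
                     (restriction-weight≤α {G} {H i} (iso i) ind (two i) (αb i))
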